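{- Let $P$ be an augmented program, $M$ a set of atoms and $\overline{M}=\sigma_P\setminus M$. Then $M$ is a min-answer set of $P$ (i.e. $M$ is both an answer set of $P$ and a minimal model of $P$) if and only if $P\cup\neg\overline{M}\ \vdash^c_I\ M$.
   Context: Formulas are propositional over atoms with $\land,\lor,\leftarrow$ (implication) and $\bot$; $\neg F$ abbreviates $\bot\leftarrow F$, $\top$ abbreviates $\bot\leftarrow\bot$. $\sigma_P$ is the set of atoms occurring in $P$. A nested formula is built from atoms, $\bot,\top$ using $\land,\lor,\neg$; an augmented program is a finite set of clauses $H\leftarrow B$ with $H,B$ nested formulas. Answer sets: basic formulas are built from atoms, $\bot,\top$ with $\land,\lor$. For a set of atoms $X$: $X\models a$ iff $a\in X$, $X\models\top$, $X\not\models\bot$, $X\models F\land G$ iff both, $X\models F\lor G$ iff either. $X$ is closed under a basic program $Q$ if for each $H\leftarrow B\in Q$, $X\models B$ implies $X\models H$; $X$ is an answer set of basic $Q$ if $\subseteq$-minimal among sets closed under $Q$. Reduct: $F^X=F$ for atoms, $\bot,\top$; $(F\land G)^X=F^X\land G^X$; $(F\lor G)^X=F^X\lor G^X$; $(\neg F)^X=\bot$ if $X\models F^X$, else $\top$; $(H\leftarrow B)^X=H^X\leftarrow B^X$; $P^X=\{C^X:C\in P\}$. $X$ is an answer set of augmented $P$ iff $X$ is an answer set of $P^X$. A set of atoms $M$ is a model of $P$ if the classical interpretation making exactly the atoms of $M$ true satisfies every clause of $P$; a minimal model if no proper subset is a model. For a set $X$ of atoms, $\neg X=\{\neg a:a\in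 X\}$. $T\vdash_I F$ means $(F_1\land\dots\land F_n)\to F$ is a theorem of intuitionistic logic for some $F_i\in T$; $T$ is consistent if not $T\vdash_I\bot$; $T\vdash^c_I U$ means $T$ is consistent and $T\vdash_I F$ for all $F\in U$. -}

module Defs where

open import Data.Nat using (ℕ)
open import Data.Bool using (Bool; true; false; _∧_; _∨_; not; if_then_else_)
open import Data.List using (List; []; _∷_)
open import Data.List.Membership.Propositional using (_∈_)
open import Data.List.Relation.Unary.All using (All)
open import Data.List.Relation.Unary.Any using (Any)
open import Data.Product using (_×_; Σ; ∃-syntax; _,_)
open import Data.Sum using (_⊎_)
open import Relation.Binary.PropositionalEquality using (_≡_)
open import Relation.Nullary using (¬_)

Atom : Set
Atom = ℕ

AtomSet : Set
AtomSet = Atom → Bool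

_∈ₛ_ : Atom → AtomSet → Set
a ∈ₛ X = X a ≡ true

_⊆ₛ_ : AtomSet → AtomSet → Set
X ⊆ₛ Y = ∀ a → a ∈ₛ X → a ∈ₛ Y

data Formula : Set where
  atom : Atom → Formula
  ⊥f   : Formula
  _∧f_ : Formula → Formula → Formula
  _∨f_ : Formula → Formula → Formula
  _←f_ : Formula → Formula → Formula   -- F ←f G  is "F if G", i.e. G → F

¬f_ : Formula → Formula
¬f F = ⊥f ←f F

⊤f : Formula
⊤f = ⊥f ←f ⊥f

data Nested : Set where
  atom : Atom → Nested
  ⊥n   : Nested
  ⊤n   : Nested
  _∧n_ : Nested → Nested → Nested
  _∨n_ : Nested → Nested → Nested
  ¬n_  : Nested → Nested

record Clause : Set where
  constructor _⇐_
  field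
    head : Nested
    body : Nested

Program : Set
Program = List Clause

toF : Nested → Formula
toF (atom a) = atom a
toF ⊥n = ⊥f
toF ⊤n = ⊤f
toF (F ∧n G) = toF F ∧f toF G
toF (F ∨n G) = toF F ∨f toF G
toF (¬n F) = ¬f (toF F)

clauseF : Clause → Formula
clauseF (H ⇐ B) = toF H ←f toF B

data OccursN (a : Atom) : Nested → Set where
  here : OccursN a (atom a)
  ∧l : ∀ {F G} → OccursN a F → OccursN a (F ∧n G)
  ∧r : ∀ {F G} → OccursN a G → OccursN a (F ∧n G)
  ∨l : ∀ {F G} → OccursN a F → OccursN a (F ∨n G)
  ∨r : ∀ {F G} → OccursN a G → OccursN a (F ∨n G)
  ¬o : ∀ {F} → OccursN a F → OccursN a (¬n F)

OccursC : Atom → Clause → Set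
OccursC a (H ⇐ B) = OccursN a H ⊎ OccursN a B

_∈σ_ : Atom → Program → Set
a ∈σ P = Any (OccursC a) P

data Basic : Set where
  atom : Atom → Basic
  ⊥b   : Basic
  ⊤b   : Basic
  _∧b_ : Basic → Basic → Basic
  _∨b_ : Basic → Basic → Basic

record BClause : Set where
  constructor _⇐b_
  field
    head : Basic
    body : Basic

BasicProgram : Set
BasicProgram = List BClause

sat : AtomSet → Basic → Bool
sat X (atom a) = X a
sat X ⊥b = false
sat X ⊤b = true
sat X (F ∧b G) = sat X F ∧ sat X G
sat X (F ∨b G) = sat X F ∨ sat X G

_⊨_ : AtomSet → Basic → Set
X ⊨ F = sat X F ≡ true

Closed : AtomSet → BasicProgram → Set
Closed X Q = ∀ {c} → c ∈ Q → X ⊨ BClause.body c → X ⊨ BClause.head c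

BasicAnswerSet : AtomSet → BasicProgram → Set
BasicAnswerSet X Q = Closed X Q × (∀ Y → Closed Y Q → Y ⊆ₛ X → X ⊆ₛ Y)

reductN : AtomSet → Nested → Basic
reductN X (atom a) = atom a
reductN X ⊥n = ⊥b
reductN X ⊤n = ⊤b
reductN X (F ∧n G) = reductN X F ∧b reductN X G
reductN X (F ∨n G) = reductN X F ∨b reductN X G
reductN X (¬n F) = if sat X (reductN X F) then ⊥b else ⊤b

reductC : AtomSet → Clause → BClause
reductC X (H ⇐ B) = reductN X H ⇐b reductN X B

reduct : AtomSet → Program → BasicProgram
reduct X [] = []
reduct X (c ∷ P) = reductC X c ∷ reduct X P

AnswerSet : AtomSet → Program → Set
AnswerSet X P = BasicAnswerSet X (reduct X P)

evalN : AtomSet → Nested → Bool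
evalN M (atom a) = M a
evalN M ⊥n = false
evalN M ⊤n = true
evalN M (F ∧n G) = evalN M F ∧ evalN M G
evalN M (F ∨n G) = evalN M F ∨ evalN M G
evalN M (¬n F) = not (evalN M F)

Model : AtomSet → Program → Set
Model M P = ∀ {c} → c ∈ P → evalN M (Clause.body c) ≡ true → evalN M (Clause.head c) ≡ true

MinimalModel : AtomSet → Program → Set
MinimalModel M P = Model M P × (∀ Y → Model Y P → Y ⊆ₛ M → M ⊆ₛ Y)

MinAnswerSet : AtomSet → Program → Set
MinAnswerSet M P = AnswerSet M P × MinimalModel M P

infix 3 _⊢_
data _⊢_ (Γ : List Formula) : Formula → Set where
  hyp  : ∀ {F} → F ∈ Γ → Γ ⊢ F
  ∧I   : ∀ {F G} → Γ ⊢ F → Γ ⊢ G → Γ ⊢ F ∧f G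
  ∧E₁  : ∀ {F G} → Γ ⊢ F ∧f G → Γ ⊢ F
  ∧E₂  : ∀ {F G} → Γ ⊢ F ∧f G → Γ ⊢ G
  ∨I₁  : ∀ {F G} → Γ ⊢ F → Γ ⊢ F ∨f G
  ∨I₂  : ∀ {F G} → Γ ⊢ G → Γ ⊢ F ∨f G
  ∨E   : ∀ {F G C} → Γ ⊢ F ∨f G → (F ∷ Γ) ⊢ C → (G ∷ Γ) ⊢ C → Γ ⊢ C
  →I   : ∀ {F G} → (F ∷ Γ) ⊢ G → Γ ⊢ G ←f F
  →E   : ∀ {F G} → Γ ⊢ G ←f F → Γ ⊢ F → Γ ⊢ G
  ⊥E   : ∀ {F} → Γ ⊢ ⊥f → Γ ⊢ F

IThm : Formula → Set
IThm F = [] ⊢ F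

bigAnd : List Formula → Formula
bigAnd [] = ⊤f
bigAnd (F ∷ []) = F
bigAnd (F ∷ G ∷ Fs) = F ∧f bigAnd (G ∷ Fs)

Theory : Set₁
Theory = Formula → Set

_⊢I_ : Theory → Formula → Set
T ⊢I F = Σ (List Formula) λ Fs → All T Fs × IThm (F ←f bigAnd Fs)

Consistent : Theory → Set
Consistent T = ¬ (T ⊢I ⊥f)

_⊢cI_ : Theory → AtomSet → Set
T ⊢cI U = Consistent T × (∀ a → a ∈ₛ U → T ⊢I atom a)

data PNegComp (P : Program) (M : AtomSet) : Theory where
  prog : ∀ {c} → c ∈ P → PNegComp P M (clauseF c)
  neg  : ∀ {a} → a ∈σ P → M a ≡ false → PNegComp P M (¬f atom a)

{-# OPTIONS --safe #-}
module Submission where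

-- Write Γ for P ∪ ¬M̄, and say that Γ settles a formula when it proves ¬¬F if F
-- holds in M and ¬F otherwise; once Γ settles the atoms of σ_P it settles every
-- formula over them.  If Γ is consistent and proves M, it settles all atoms, so M is
-- a model of P; classical soundness in a model Y ⊆ M of P gives M ⊆ Y, and soundness
-- in the here-and-there model (Y, M) does the same for Y closed under P^M, because
-- here-truth of a nested formula is truth of its reduct.  Conversely, for a
-- min-answer set M and x ∈ M the theory Γ, ¬x has no classical model, so Γ ⊢ ¬¬x by
-- Glivenko's theorem.  With all atoms settled, Γ proves each nested formula
-- equivalent to its reduct, hence proves the positive program P^M, and its minimal
-- closed set M is derived one violated clause at a time, the premises ¬y discarding
-- the disjuncts that leave M.

open import Defs
open import Function.Base using (id; _∘_; const)
open import Function.Bundles using (_⇔_; mk⇔; module Equivalence)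
open Equivalence using (to; from)
open import Data.Bool using (Bool; true; false; _∧_; _∨_; not; _≟_)
open import Data.Bool.Properties using (∧-conicalˡ; ∧-conicalʳ; ∨-conicalˡ; ∨-conicalʳ; ∨-zeroʳ; ∧-identityʳ; ∧-zeroʳ; ¬-not)
open import Data.Nat using (_<_)
open import Data.Nat.Properties using () renaming (_≟_ to _≟ᴺ_)
open import Data.Nat.Induction using (<-wellFounded)
open import Induction.WellFounded using (Acc; acc)
open import Data.List using (List; []; _∷_; _++_; map; concatMap; filter; length)
open import Data.List.Properties using (filter-notAll)
open import Data.List.Membership.Propositional using (_∈_; lose; find)
open import Data.List.Membership.Propositional.Properties using (∈-++⁺ˡ; ∈-++⁺ʳ; ∈-++⁻; ∈-map⁺; ∈-map⁻; ∈-concatMap⁺; ∈-concatMap⁻; ∈-filter⁺; ∈-filter⁻)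
open import Data.List.Relation.Binary.Subset.Propositional using (_⊆_)
open import Data.List.Relation.Binary.Subset.Propositional.Properties using (∷⁺ʳ; xs⊆xs++ys)
open import Data.List.Relation.Unary.All as All using (All; []; _∷_)
open import Data.List.Relation.Unary.Any as Any using (here; there; any?)
open import Data.Product using (_×_; _,_; proj₁; proj₂; ∃-syntax)
open import Data.Sum as Sum using (_⊎_; inj₁; inj₂; [_,_])
open import Data.Empty using (⊥; ⊥-elim)
open import Relation.Binary.PropositionalEquality using (_≡_; refl; sym; trans; cong; cong₂; subst)
open import Relation.Nullary using (¬_; yes; no; contradiction)
open import Relation.Nullary.Decidable using (_×-dec_)

-- Natural deduction

weaken : ∀ {Γ Δ F} → Γ ⊆ Δ → Γ ⊢ F → Δ ⊢ F
weaken s (hyp p)    = hyp (s p)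
weaken s (∧I d e)   = ∧I (weaken s d) (weaken s e)
weaken s (∧E₁ d)    = ∧E₁ (weaken s d)
weaken s (∧E₂ d)    = ∧E₂ (weaken s d)
weaken s (∨I₁ d)    = ∨I₁ (weaken s d)
weaken s (∨I₂ d)    = ∨I₂ (weaken s d)
weaken s (∨E d e f) = ∨E (weaken s d) (weaken (∷⁺ʳ _ s) e) (weaken (∷⁺ʳ _ s) f)
weaken s (→I d)     = →I (weaken (∷⁺ʳ _ s) d)
weaken s (→E d e)   = →E (weaken s d) (weaken s e)
weaken s (⊥E d)     = ⊥E (weaken s d)

weaken₁ : ∀ {Γ F G} → Γ ⊢ F → G ∷ Γ ⊢ F
weaken₁ = weaken there

hyp₀ : ∀ {Γ F} → F ∷ Γ ⊢ F
hyp₀ = hyp (here refl)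

hyp₁ : ∀ {Γ F G} → G ∷ F ∷ Γ ⊢ F
hyp₁ = hyp (there (here refl))

⊤-intro : ∀ {Γ} → Γ ⊢ ⊤f
⊤-intro = →I hyp₀

¬¬-intro : ∀ {Γ F} → Γ ⊢ F → Γ ⊢ ¬f ¬f F
¬¬-intro d = →I (→E hyp₀ (weaken₁ d))

module _ {Γ : List Formula} {A B : Formula} where

  ¬¬-∧ : Γ ⊢ ¬f ¬f A → Γ ⊢ ¬f ¬f B → Γ ⊢ ¬f ¬f (A ∧f B)
  ¬¬-∧ dA dB = →I (→E (weaken₁ dA) (→I (→E (weaken₁ (weaken₁ dB))
                 (→I (→E (hyp (there (there (here refl)))) (∧I hyp₁ hyp₀))))))

  ¬-∧ˡ : Γ ⊢ ¬f A → Γ ⊢ ¬f (A ∧f B)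
  ¬-∧ˡ d = →I (→E (weaken₁ d) (∧E₁ hyp₀))

  ¬-∧ʳ : Γ ⊢ ¬f B → Γ ⊢ ¬f (A ∧f B)
  ¬-∧ʳ d = →I (→E (weaken₁ d) (∧E₂ hyp₀))

  ¬¬-∨ˡ : Γ ⊢ ¬f ¬f A → Γ ⊢ ¬f ¬f (A ∨f B)
  ¬¬-∨ˡ d = →I (→E (weaken₁ d) (→I (→E hyp₁ (∨I₁ hyp₀))))

  ¬¬-∨ʳ : Γ ⊢ ¬f ¬f B → Γ ⊢ ¬f ¬f (A ∨f B)
  ¬¬-∨ʳ d = →I (→E (weaken₁ d) (→I (→E hyp₁ (∨I₂ hyp₀))))

  ¬-∨ : Γ ⊢ ¬f A → Γ ⊢ ¬f B → Γ ⊢ ¬f (A ∨f B)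
  ¬-∨ dA dB = →I (∨E hyp₀ (→E (weaken₁ (weaken₁ dA)) hyp₀) (→E (weaken₁ (weaken₁ dB)) hyp₀))

  ¬¬-←-head : Γ ⊢ ¬f ¬f B → Γ ⊢ ¬f ¬f (B ←f A)
  ¬¬-←-head d = →I (→E (weaken₁ d) (→I (→E hyp₁ (→I hyp₁))))

  ¬¬-←-body : Γ ⊢ ¬f A → Γ ⊢ ¬f ¬f (B ←f A)
  ¬¬-←-body d = ¬¬-intro (→I (⊥E (→E (weaken₁ d) hyp₀)))

  ¬-← : Γ ⊢ ¬f ¬f A → Γ ⊢ ¬f B → Γ ⊢ ¬f (B ←f A)
  ¬-← dA dB = →I (→E (weaken₁ dA) (→I (→E (weaken₁ (weaken₁ dB)) (→E hyp₁ hyp₀))))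

module _ {Γ : List Formula} {A A′ B B′ : Formula} where

  ∧-mono : Γ ⊢ A′ ←f A → Γ ⊢ B′ ←f B → Γ ⊢ (A′ ∧f B′) ←f (A ∧f B)
  ∧-mono d e = →I (∧I (→E (weaken₁ d) (∧E₁ hyp₀)) (→E (weaken₁ e) (∧E₂ hyp₀)))

  ∨-mono : Γ ⊢ A′ ←f A → Γ ⊢ B′ ←f B → Γ ⊢ (A′ ∨f B′) ←f (A ∨f B)
  ∨-mono d e = →I (∨E hyp₀ (∨I₁ (→E (weaken₁ (weaken₁ d)) hyp₀))
                           (∨I₂ (→E (weaken₁ (weaken₁ e)) hyp₀)))

←-trans : ∀ {Δ A B C} → Δ ⊢ C ←f B → Δ ⊢ B ←f A → Δ ⊢ C ←f A
←-trans d e = →I (→E (weaken₁ d) (→E (weaken₁ e) hyp₀))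

⋀-intro : ∀ {Δ} Fs → All (Δ ⊢_) Fs → Δ ⊢ bigAnd Fs
⋀-intro []           []       = ⊤-intro
⋀-intro (F ∷ [])     (d ∷ []) = d
⋀-intro (F ∷ G ∷ Fs) (d ∷ ds) = ∧I d (⋀-intro (G ∷ Fs) ds)

⋀-elim : ∀ Fs {Δ C} → Fs ++ Δ ⊢ C → bigAnd Fs ∷ Δ ⊢ C
⋀-elim []           d = weaken₁ d
⋀-elim (F ∷ [])     d = d
⋀-elim (F ∷ G ∷ Fs) d =
  →E (→E (→I (weaken (∷⁺ʳ _ there) (⋀-elim (G ∷ Fs) (→I d)))) (∧E₂ hyp₀)) (∧E₁ hyp₀)

⊢⇒⊢I : ∀ {T : Theory} {Γ F} → All T Γ → Γ ⊢ F → T ⊢I F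
⊢⇒⊢I {Γ = Γ} TΓ d = Γ , TΓ , →I (⋀-elim Γ (weaken (xs⊆xs++ys Γ []) d))

⊢I⇒⊢ : ∀ {T : Theory} {Γ F} → (∀ {G} → T G → G ∈ Γ) → T ⊢I F → Γ ⊢ F
⊢I⇒⊢ T⊆Γ (Fs , TFs , d) = →E (weaken (λ ()) d) (⋀-intro Fs (All.map (λ TG → hyp (T⊆Γ TG)) TFs))

-- Classical and here-and-there semantics

⟦_⟧ : Formula → AtomSet → Set
⟦ atom a ⟧  X = a ∈ₛ X
⟦ ⊥f ⟧      X = ⊥
⟦ F ∧f G ⟧  X = ⟦ F ⟧ X × ⟦ G ⟧ X
⟦ F ∨f G ⟧  X = ⟦ F ⟧ X ⊎ ⟦ G ⟧ X
⟦ G ←f F ⟧  X = ⟦ F ⟧ X → ⟦ G ⟧ X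

⟦⟧-sound : ∀ X {Γ F} → Γ ⊢ F → All (λ G → ⟦ G ⟧ X) Γ → ⟦ F ⟧ X
⟦⟧-sound X (hyp p)    ρ = All.lookup ρ p
⟦⟧-sound X (∧I d e)   ρ = ⟦⟧-sound X d ρ , ⟦⟧-sound X e ρ
⟦⟧-sound X (∧E₁ d)    ρ = proj₁ (⟦⟧-sound X d ρ)
⟦⟧-sound X (∧E₂ d)    ρ = proj₂ (⟦⟧-sound X d ρ)
⟦⟧-sound X (∨I₁ d)    ρ = inj₁ (⟦⟧-sound X d ρ)
⟦⟧-sound X (∨I₂ d)    ρ = inj₂ (⟦⟧-sound X d ρ)
⟦⟧-sound X (∨E d e f) ρ = [ (λ a → ⟦⟧-sound X e (a ∷ ρ)) , (λ b → ⟦⟧-sound X f (b ∷ ρ)) ] (⟦⟧-sound X d ρ)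
⟦⟧-sound X (→I d)     ρ = λ a → ⟦⟧-sound X d (a ∷ ρ)
⟦⟧-sound X (→E d e)   ρ = ⟦⟧-sound X d ρ (⟦⟧-sound X e ρ)
⟦⟧-sound X (⊥E d)     ρ = ⊥-elim (⟦⟧-sound X d ρ)

-- Here-and-there: the two-world Kripke model "here" Y ⊆ "there" X, where an
-- implication must hold at both worlds.
⟦_⟧ₕₜ : Formula → AtomSet → AtomSet → Set
⟦ atom a ⟧ₕₜ Y X = a ∈ₛ Y
⟦ ⊥f ⟧ₕₜ     Y X = ⊥
⟦ F ∧f G ⟧ₕₜ Y X = ⟦ F ⟧ₕₜ Y X × ⟦ G ⟧ₕₜ Y X
⟦ F ∨f G ⟧ₕₜ Y X = ⟦ F ⟧ₕₜ Y X ⊎ ⟦ G ⟧ₕₜ Y X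
⟦ G ←f F ⟧ₕₜ Y X = (⟦ F ⟧ₕₜ Y X → ⟦ G ⟧ₕₜ Y X) × ⟦ G ←f F ⟧ X

persistence : ∀ {Y X} → Y ⊆ₛ X → ∀ F → ⟦ F ⟧ₕₜ Y X → ⟦ F ⟧ X
persistence Y⊆X (atom a) y        = Y⊆X a y
persistence Y⊆X (F ∧f G) (f , g)  = persistence Y⊆X F f , persistence Y⊆X G g
persistence Y⊆X (F ∨f G) (inj₁ f) = inj₁ (persistence Y⊆X F f)
persistence Y⊆X (F ∨f G) (inj₂ g) = inj₂ (persistence Y⊆X G g)
persistence Y⊆X (G ←f F) (_ , h)  = h

⟦⟧ₕₜ-sound : ∀ {Y X} → Y ⊆ₛ X → ∀ {Γ F} → Γ ⊢ F → All (λ G → ⟦ G ⟧ₕₜ Y X) Γ → ⟦ F ⟧ₕₜ Y X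
⟦⟧ₕₜ-sound s (hyp p)    ρ = All.lookup ρ p
⟦⟧ₕₜ-sound s (∧I d e)   ρ = ⟦⟧ₕₜ-sound s d ρ , ⟦⟧ₕₜ-sound s e ρ
⟦⟧ₕₜ-sound s (∧E₁ d)    ρ = proj₁ (⟦⟧ₕₜ-sound s d ρ)
⟦⟧ₕₜ-sound s (∧E₂ d)    ρ = proj₂ (⟦⟧ₕₜ-sound s d ρ)
⟦⟧ₕₜ-sound s (∨I₁ d)    ρ = inj₁ (⟦⟧ₕₜ-sound s d ρ)
⟦⟧ₕₜ-sound s (∨I₂ d)    ρ = inj₂ (⟦⟧ₕₜ-sound s d ρ)
⟦⟧ₕₜ-sound s (∨E d e f) ρ =
  [ (λ a → ⟦⟧ₕₜ-sound s e (a ∷ ρ)) , (λ b → ⟦⟧ₕₜ-sound s f (b ∷ ρ)) ] (⟦⟧ₕₜ-sound s d ρ)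
⟦⟧ₕₜ-sound {X = X} s (→I d) ρ =
  (λ a → ⟦⟧ₕₜ-sound s d (a ∷ ρ)) ,
  (λ a → ⟦⟧-sound X d (a ∷ All.map (persistence s _) ρ))
⟦⟧ₕₜ-sound s (→E d e)   ρ = proj₁ (⟦⟧ₕₜ-sound s d ρ) (⟦⟧ₕₜ-sound s e ρ)
⟦⟧ₕₜ-sound s (⊥E d)     ρ = ⊥-elim (⟦⟧ₕₜ-sound s d ρ)

-- Glivenko's theorem

atoms : Formula → List Atom
atoms (atom a) = a ∷ []
atoms ⊥f       = []
atoms (F ∧f G) = atoms F ++ atoms G
atoms (F ∨f G) = atoms F ++ atoms G
atoms (F ←f G) = atoms F ++ atoms G

⟦⟧-cong : ∀ {X Y} F → (∀ {y} → y ∈ atoms F → X y ≡ Y y) → ⟦ F ⟧ X → ⟦ F ⟧ Y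
⟦⟧-cong (atom a) X≡Y x        = trans (sym (X≡Y (here refl))) x
⟦⟧-cong (F ∧f G) X≡Y (f , g)  = ⟦⟧-cong F (X≡Y ∘ ∈-++⁺ˡ) f , ⟦⟧-cong G (X≡Y ∘ ∈-++⁺ʳ (atoms F)) g
⟦⟧-cong (F ∨f G) X≡Y (inj₁ f) = inj₁ (⟦⟧-cong F (X≡Y ∘ ∈-++⁺ˡ) f)
⟦⟧-cong (F ∨f G) X≡Y (inj₂ g) = inj₂ (⟦⟧-cong G (X≡Y ∘ ∈-++⁺ʳ (atoms F)) g)
⟦⟧-cong (G ←f F) X≡Y h        =
  ⟦⟧-cong G (X≡Y ∘ ∈-++⁺ˡ) ∘ h ∘ ⟦⟧-cong F (sym ∘ X≡Y ∘ ∈-++⁺ʳ (atoms G))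

Settles : List Formula → AtomSet → Formula → Set
Settles Δ X F = (⟦ F ⟧ X × Δ ⊢ ¬f ¬f F) ⊎ (¬ ⟦ F ⟧ X × Δ ⊢ ¬f F)

settles : ∀ {Δ X} F → (∀ {y} → y ∈ atoms F → Settles Δ X (atom y)) → Settles Δ X F
settles (atom a) s = s (here refl)
settles ⊥f       s = inj₂ (id , ⊤-intro)
settles (F ∧f G) s with settles F (s ∘ ∈-++⁺ˡ) | settles G (s ∘ ∈-++⁺ʳ (atoms F))
... | inj₁ (f , dF) | inj₁ (g , dG) = inj₁ ((f , g) , ¬¬-∧ dF dG)
... | inj₂ (f✗ , dF) | _            = inj₂ (f✗ ∘ proj₁ , ¬-∧ˡ dF)
... | inj₁ _ | inj₂ (g✗ , dG)       = inj₂ (g✗ ∘ proj₂ , ¬-∧ʳ dG)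
settles (F ∨f G) s with settles F (s ∘ ∈-++⁺ˡ) | settles G (s ∘ ∈-++⁺ʳ (atoms F))
... | inj₁ (f , dF) | _              = inj₁ (inj₁ f , ¬¬-∨ˡ dF)
... | inj₂ _ | inj₁ (g , dG)         = inj₁ (inj₂ g , ¬¬-∨ʳ dG)
... | inj₂ (f✗ , dF) | inj₂ (g✗ , dG) = inj₂ ([ f✗ , g✗ ] , ¬-∨ dF dG)
settles (G ←f F) s with settles G (s ∘ ∈-++⁺ˡ) | settles F (s ∘ ∈-++⁺ʳ (atoms G))
... | inj₁ (g , dG) | _              = inj₁ (const g , ¬¬-←-head dG)
... | inj₂ _ | inj₂ (f✗ , dF)        = inj₁ (⊥-elim ∘ f✗ , ¬¬-←-body dF)
... | inj₂ (g✗ , dG) | inj₁ (f , dF) = inj₂ ((λ h → g✗ (h f)) , ¬-← dF dG)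

literal : Bool → Atom → Formula
literal true  a = atom a
literal false a = ¬f atom a

settles-literal : ∀ {Δ N y} → literal (N y) y ∈ Δ → Settles Δ N (atom y)
settles-literal {N = N} {y} l with N y
... | true  = inj₁ (refl , ¬¬-intro (hyp l))
... | false = inj₂ ((λ ()) , hyp l)

update : AtomSet → Atom → Bool → AtomSet
update N x b y with y ≟ᴺ x
... | yes _ = b
... | no _  = N y

refute-by-cases : ∀ L {Δ} →
  (∀ (N : AtomSet) {Δ′} → Δ ⊆ Δ′ → (∀ {y} → y ∈ L → literal (N y) y ∈ Δ′) → Δ′ ⊢ ⊥f) →
  Δ ⊢ ⊥f
refute-by-cases []      k = k (const false) id (λ ())
refute-by-cases (x ∷ L) {Δ} k = →E (→I (assume false)) (→I (assume true))
  where
  assume : ∀ b → literal b x ∷ Δ ⊢ ⊥f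
  assume b = refute-by-cases L λ N {Δ′} s lits → k (update N x b) (s ∘ there) (lits′ N s lits)
    where
    lits′ : ∀ (N : AtomSet) {Δ′} → literal b x ∷ Δ ⊆ Δ′ → (∀ {y} → y ∈ L → literal (N y) y ∈ Δ′) →
            ∀ {y} → y ∈ x ∷ L → literal (update N x b y) y ∈ Δ′
    lits′ N s lits {y} y∈ with y ≟ᴺ x
    ... | yes refl = s (here refl)
    ... | no y≢x   = lits (Any.tail y≢x y∈)

glivenko : ∀ Γ → (∀ N → ¬ All (λ F → ⟦ F ⟧ N) Γ) → Γ ⊢ ⊥f
glivenko Γ unsat = refute-by-cases (concatMap atoms Γ) λ N Γ⊆Δ lits →
  refute Γ⊆Δ (unsat N) (All.tabulate λ {F} F∈Γ →
    settles F λ y∈F → settles-literal {N = N} (lits (∈-concatMap⁺ atoms (lose F∈Γ y∈F))))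
  where
  refute : ∀ {N Γ Δ} → Γ ⊆ Δ → ¬ All (λ F → ⟦ F ⟧ N) Γ → All (Settles Δ N) Γ → Δ ⊢ ⊥f
  refute {Γ = []}    _   unsat []                  = ⊥-elim (unsat [])
  refute {Γ = F ∷ Γ} Γ⊆Δ unsat (inj₁ (f , _) ∷ ss) = refute (Γ⊆Δ ∘ there) (unsat ∘ (f ∷_)) ss
  refute {Γ = F ∷ Γ} Γ⊆Δ unsat (inj₂ (_ , ¬F) ∷ _) = →E ¬F (hyp (Γ⊆Δ (here refl)))

-- Positive formulas and programs

toB : Basic → Formula
toB (atom a) = atom a
toB ⊥b       = ⊥f
toB ⊤b       = ⊤f
toB (F ∧b G) = toB F ∧f toB G
toB (F ∨b G) = toB F ∨f toB G

∨-true⁺ˡ : ∀ {a} b → a ≡ true → a ∨ b ≡ true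
∨-true⁺ˡ b = cong (_∨ b)

∨-true⁺ʳ : ∀ a {b} → b ≡ true → a ∨ b ≡ true
∨-true⁺ʳ a b = trans (cong (a ∨_) b) (∨-zeroʳ a)

∨-true⁻ : ∀ {a b} → a ∨ b ≡ true → a ≡ true ⊎ b ≡ true
∨-true⁻ {true}  _ = inj₁ refl
∨-true⁻ {false} b = inj₂ b

_⊢ₛ_ : List Formula → AtomSet → Set
Δ ⊢ₛ X = ∀ {y} → y ∈ₛ X → Δ ⊢ atom y

∅ : AtomSet
∅ _ = false

singleton : Atom → AtomSet
singleton a y with y ≟ᴺ a
... | yes _ = true
... | no _  = false

a∈singleton : ∀ a → a ∈ₛ singleton a
a∈singleton a with a ≟ᴺ a
... | yes _  = refl
... | no a≢a = contradiction refl a≢a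

_∪_ : AtomSet → AtomSet → AtomSet
(X ∪ Y) y = X y ∨ Y y

_∩_ : AtomSet → AtomSet → AtomSet
(X ∩ Y) y = X y ∧ Y y

⊢ₛ-singleton : ∀ {Δ a} → Δ ⊢ atom a → Δ ⊢ₛ singleton a
⊢ₛ-singleton {a = a} d {y} _ with y ≟ᴺ a
⊢ₛ-singleton d () | no _
⊢ₛ-singleton d _  | yes refl = d

⊢ₛ-∪ : ∀ {Δ X Y} → Δ ⊢ₛ X → Δ ⊢ₛ Y → Δ ⊢ₛ (X ∪ Y)
⊢ₛ-∪ {X = X} dX dY {y} _ with X y in Xy
⊢ₛ-∪ dX dY _  | true  = dX Xy
⊢ₛ-∪ dX dY Yy | false = dY Yy

X⊆X∪Y : ∀ {X Y} → X ⊆ₛ (X ∪ Y)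
X⊆X∪Y {Y = Y} a = ∨-true⁺ˡ (Y a)

Y⊆X∪Y : ∀ {X Y} → Y ⊆ₛ (X ∪ Y)
Y⊆X∪Y {X = X} a = ∨-true⁺ʳ (X a)

∪-least : ∀ {X Y Z} → X ⊆ₛ Z → Y ⊆ₛ Z → (X ∪ Y) ⊆ₛ Z
∪-least {X} X⊆Z Y⊆Z a with X a in Xa
... | true  = λ _ → X⊆Z a Xa
... | false = Y⊆Z a

X∩Y⊆X : ∀ {X Y} → (X ∩ Y) ⊆ₛ X
X∩Y⊆X a = ∧-conicalˡ _ _

X∩Y⊆Y : ∀ {X Y} → (X ∩ Y) ⊆ₛ Y
X∩Y⊆Y a = ∧-conicalʳ _ _

sat-witness : ∀ {X Y} F → X ⊨ F → sat Y F ≡ false →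
              ∃[ y ] y ∈ atoms (toB F) × y ∈ₛ X × Y y ≡ false
sat-witness (atom a) x ¬y = a , here refl , x , ¬y
sat-witness {Y = Y} (F ∧b G) fg ¬fg with sat Y F in eq
... | false = let y , y∈ , x , ¬y = sat-witness F (∧-conicalˡ _ _ fg) eq
              in y , ∈-++⁺ˡ y∈ , x , ¬y
... | true  = let y , y∈ , x , ¬y = sat-witness G (∧-conicalʳ _ _ fg) ¬fg
              in y , ∈-++⁺ʳ (atoms (toB F)) y∈ , x , ¬y
sat-witness {X = X} (F ∨b G) fg ¬fg with sat X F in eq
... | true  = let y , y∈ , x , ¬y = sat-witness F eq (∨-conicalˡ _ _ ¬fg)
              in y , ∈-++⁺ˡ y∈ , x , ¬y
... | false = let y , y∈ , x , ¬y = sat-witness G fg (∨-conicalʳ _ _ ¬fg)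
              in y , ∈-++⁺ʳ (atoms (toB F)) y∈ , x , ¬y

sat-mono : ∀ {X Y} → X ⊆ₛ Y → ∀ F → X ⊨ F → Y ⊨ F
sat-mono {Y = Y} X⊆Y F x with sat Y F in eq
... | true  = refl
... | false = let y , _ , x , ¬y = sat-witness F x eq
              in contradiction (trans (sym ¬y) (X⊆Y y x)) λ ()

⊨⇒⊢ : ∀ {Δ X} F → X ⊨ F → Δ ⊢ₛ X → Δ ⊢ toB F
⊨⇒⊢ (atom a) x dX = dX x
⊨⇒⊢ ⊤b       _ dX = ⊤-intro
⊨⇒⊢ {X = X} (F ∧b G) fg dX =
  ∧I (⊨⇒⊢ F (∧-conicalˡ _ _ fg) dX) (⊨⇒⊢ G (∧-conicalʳ _ _ fg) dX)
⊨⇒⊢ {X = X} (F ∨b G) fg dX with sat X F in eq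
... | true  = ∨I₁ (⊨⇒⊢ F eq dX)
... | false = ∨I₂ (⊨⇒⊢ G fg dX)

⊢toB-elim : ∀ {Δ C} F → Δ ⊢ toB F →
            (∀ {Δ′} → Δ ⊆ Δ′ → ∀ T → T ⊨ F → Δ′ ⊢ₛ T → Δ′ ⊢ C) → Δ ⊢ C
⊢toB-elim (atom a) d k = k id (singleton a) (a∈singleton a) (⊢ₛ-singleton d)
⊢toB-elim ⊥b       d k = ⊥E d
⊢toB-elim ⊤b       d k = k id ∅ refl (λ ())
⊢toB-elim (F ∧b G) d k =
  ⊢toB-elim F (∧E₁ d) λ Δ⊆Δ₁ T₁ f dT₁ →
  ⊢toB-elim G (weaken Δ⊆Δ₁ (∧E₂ d)) λ Δ₁⊆Δ₂ T₂ g dT₂ →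
  k (Δ₁⊆Δ₂ ∘ Δ⊆Δ₁) (T₁ ∪ T₂)
    (cong₂ _∧_ (sat-mono X⊆X∪Y F f) (sat-mono Y⊆X∪Y G g))
    (⊢ₛ-∪ (weaken Δ₁⊆Δ₂ ∘ dT₁) dT₂)
⊢toB-elim (F ∨b G) d k =
  ∨E d (⊢toB-elim F hyp₀ λ s T f → k (s ∘ there) T (∨-true⁺ˡ (sat T G) f))
       (⊢toB-elim G hyp₀ λ s T g → k (s ∘ there) T (∨-true⁺ʳ (sat T F) g))

closed-or-violated : ∀ X Q →
  Closed X Q ⊎ ∃[ c ] c ∈ Q × X ⊨ BClause.body c × sat X (BClause.head c) ≡ false
closed-or-violated X Q
  with any? (λ c → (sat X (BClause.body c) ≟ true) ×-dec (sat X (BClause.head c) ≟ false)) Q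
... | yes violated = inj₂ (find violated)
... | no ¬violated = inj₁ λ c∈Q b → ¬-not λ h → ¬violated (lose c∈Q (b , h))

module _ {Q : BasicProgram} {M : AtomSet} {Δ : List Formula}
         (minimal : ∀ Y → Closed Y Q → Y ⊆ₛ M → M ⊆ₛ Y)
         (⊢clause : ∀ {H B} → H ⇐b B ∈ Q → Δ ⊢ toB H ←f toB B)
         (⊢¬head : ∀ {H B y} → H ⇐b B ∈ Q → y ∈ atoms (toB H) → M y ≡ false → Δ ⊢ ¬f atom y)
  where

  private
    headAtoms : List Atom
    headAtoms = concatMap (atoms ∘ toB ∘ BClause.head) Q

    -- The recursion is on the length of U, which bounds the head atoms of M not yet in S.
    Pending : AtomSet → List Atom → Set
    Pending S U = ∀ {y} → y ∈ headAtoms → y ∈ₛ M → S y ≡ false → y ∈ U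

    Pending-∪ : ∀ {N S U} → Pending S U → Pending (N ∪ S) (filter (λ z → N z ≟ false) U)
    Pending-∪ pending y∈ My ¬NSy =
      ∈-filter⁺ _ (pending y∈ My (∨-conicalʳ _ _ ¬NSy)) (∨-conicalˡ _ _ ¬NSy)

    -- If a ∉ S then S is not closed.  A violated clause H ← B yields H, and each set T
    -- of atoms making H true either leaves M, refuted by ⊢¬head, or contributes to S a
    -- new atom of M.
    derive : ∀ {a Δ′} → a ∈ₛ M → ∀ S U → Acc _<_ (length U) →
             Δ ⊆ Δ′ → S ⊆ₛ M → Δ′ ⊢ₛ S → Pending S U → Δ′ ⊢ atom a
    derive {a} {Δ′} a∈M S U (acc smaller) Δ⊆Δ′ S⊆M dS pending
      with S a in Sa | closed-or-violated S Q
    ... | true  | _           = dS Sa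
    ... | false | inj₁ closed = contradiction (trans (sym Sa) (minimal S closed S⊆M a a∈M)) λ ()
    ... | false | inj₂ ((H ⇐b B) , c∈Q , b , ¬h) =
      ⊢toB-elim H (→E (weaken Δ⊆Δ′ (⊢clause c∈Q)) (⊨⇒⊢ B b dS)) extend
      where
      extend : ∀ {Δ″} → Δ′ ⊆ Δ″ → ∀ T → T ⊨ H → Δ″ ⊢ₛ T → Δ″ ⊢ atom a
      extend Δ′⊆Δ″ T h dT with sat (T ∩ M) H in eq
      ... | false =
        let y , y∈H , Ty , ¬TMy = sat-witness H h eq
            ¬My = trans (sym (cong (_∧ M y) Ty)) ¬TMy
        in ⊥E (→E (weaken (Δ′⊆Δ″ ∘ Δ⊆Δ′) (⊢¬head c∈Q y∈H ¬My)) (dT Ty))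
      ... | true =
        let y , y∈H , TMy , ¬Sy = sat-witness H eq ¬h
            y∈U = pending (∈-concatMap⁺ _ (lose c∈Q y∈H)) (X∩Y⊆Y {T} {M} y TMy) ¬Sy
        in derive a∈M ((T ∩ M) ∪ S) (filter (λ z → (T ∩ M) z ≟ false) U)
             (smaller (filter-notAll _ U (lose y∈U ((λ ()) ∘ trans (sym TMy)))))
             (Δ′⊆Δ″ ∘ Δ⊆Δ′) (∪-least (X∩Y⊆Y {T} {M}) S⊆M)
             (⊢ₛ-∪ (λ {z} → dT ∘ X∩Y⊆X {T} {M} z) (weaken Δ′⊆Δ″ ∘ dS)) (Pending-∪ pending)

  minimal-closed⇒⊢ₛ : Δ ⊢ₛ M
  minimal-closed⇒⊢ₛ a∈M =
    derive a∈M ∅ headAtoms (<-wellFounded _) id (λ _ ()) (λ ()) (λ y∈ _ _ → y∈)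

-- Reducts

reduct≡map : ∀ X P → reduct X P ≡ map (reductC X) P
reduct≡map X []      = refl
reduct≡map X (c ∷ P) = cong (reductC X c ∷_) (reduct≡map X P)

∈-reduct⁺ : ∀ {X c P} → c ∈ P → reductC X c ∈ reduct X P
∈-reduct⁺ {X} {P = P} c∈P = subst (_ ∈_) (sym (reduct≡map X P)) (∈-map⁺ (reductC X) c∈P)

∈-reduct⁻ : ∀ {X c P} → c ∈ reduct X P → ∃[ c′ ] c′ ∈ P × c ≡ reductC X c′
∈-reduct⁻ {X} {P = P} c∈ = ∈-map⁻ (reductC X) (subst (_ ∈_) (reduct≡map X P) c∈)

⟦toF⟧⇔evalN : ∀ X F → ⟦ toF F ⟧ X ⇔ evalN X F ≡ true
⟦toF⟧⇔evalN X (atom a) = mk⇔ id id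
⟦toF⟧⇔evalN X ⊥n       = mk⇔ (λ ()) (λ ())
⟦toF⟧⇔evalN X ⊤n       = mk⇔ (const refl) (const id)
⟦toF⟧⇔evalN X (F ∧n G) with ⟦toF⟧⇔evalN X F | ⟦toF⟧⇔evalN X G
... | F⇔ | G⇔ = mk⇔ (λ (f , g) → cong₂ _∧_ (to F⇔ f) (to G⇔ g))
                    (λ fg → from F⇔ (∧-conicalˡ _ _ fg) , from G⇔ (∧-conicalʳ _ _ fg))
⟦toF⟧⇔evalN X (F ∨n G) with ⟦toF⟧⇔evalN X F | ⟦toF⟧⇔evalN X G
... | F⇔ | G⇔ = mk⇔ [ ∨-true⁺ˡ _ ∘ to F⇔ , ∨-true⁺ʳ _ ∘ to G⇔ ]
                    (Sum.map (from F⇔) (from G⇔) ∘ ∨-true⁻)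
⟦toF⟧⇔evalN X (¬n F) with evalN X F | ⟦toF⟧⇔evalN X F
... | true  | F⇔ = mk⇔ (λ f✗ → ⊥-elim (f✗ (from F⇔ refl))) (λ ())
... | false | F⇔ = mk⇔ (const refl) (λ _ → (λ ()) ∘ to F⇔)

sat-reduct : ∀ X F → sat X (reductN X F) ≡ evalN X F
sat-reduct X (atom a) = refl
sat-reduct X ⊥n       = refl
sat-reduct X ⊤n       = refl
sat-reduct X (F ∧n G) = cong₂ _∧_ (sat-reduct X F) (sat-reduct X G)
sat-reduct X (F ∨n G) = cong₂ _∨_ (sat-reduct X F) (sat-reduct X G)
sat-reduct X (¬n F) with sat X (reductN X F) | sat-reduct X F
... | true  | eq = cong not eq
... | false | eq = cong not eq

⟦toF⟧⇔sat-reduct : ∀ X F → ⟦ toF F ⟧ X ⇔ X ⊨ reductN X F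
⟦toF⟧⇔sat-reduct X F = subst (λ b → ⟦ toF F ⟧ X ⇔ b ≡ true) (sym (sat-reduct X F)) (⟦toF⟧⇔evalN X F)

⟦toF⟧ₕₜ⇔sat-reduct : ∀ {Y X} → Y ⊆ₛ X → ∀ F → ⟦ toF F ⟧ₕₜ Y X ⇔ Y ⊨ reductN X F
⟦toF⟧ₕₜ⇔sat-reduct Y⊆X (atom a) = mk⇔ id id
⟦toF⟧ₕₜ⇔sat-reduct Y⊆X ⊥n       = mk⇔ (λ ()) (λ ())
⟦toF⟧ₕₜ⇔sat-reduct Y⊆X ⊤n       = mk⇔ (const refl) (const (id , id))
⟦toF⟧ₕₜ⇔sat-reduct Y⊆X (F ∧n G)
  with ⟦toF⟧ₕₜ⇔sat-reduct Y⊆X F | ⟦toF⟧ₕₜ⇔sat-reduct Y⊆X G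
... | F⇔ | G⇔ = mk⇔ (λ (f , g) → cong₂ _∧_ (to F⇔ f) (to G⇔ g))
                    (λ fg → from F⇔ (∧-conicalˡ _ _ fg) , from G⇔ (∧-conicalʳ _ _ fg))
⟦toF⟧ₕₜ⇔sat-reduct Y⊆X (F ∨n G)
  with ⟦toF⟧ₕₜ⇔sat-reduct Y⊆X F | ⟦toF⟧ₕₜ⇔sat-reduct Y⊆X G
... | F⇔ | G⇔ = mk⇔ [ ∨-true⁺ˡ _ ∘ to F⇔ , ∨-true⁺ʳ _ ∘ to G⇔ ]
                    (Sum.map (from F⇔) (from G⇔) ∘ ∨-true⁻)
⟦toF⟧ₕₜ⇔sat-reduct {X = X} Y⊆X (¬n F) with sat X (reductN X F) | ⟦toF⟧⇔sat-reduct X F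
... | true  | F⇔ = mk⇔ (λ (_ , f✗) → ⊥-elim (f✗ (from F⇔ refl))) (λ ())
... | false | F⇔ = mk⇔ (const refl)
                       (const ((λ ()) ∘ to F⇔ ∘ persistence Y⊆X (toF F) , (λ ()) ∘ to F⇔))

atoms-reduct⊆ : ∀ X F → atoms (toB (reductN X F)) ⊆ atoms (toF F)
atoms-reduct⊆ X (atom a) = id
atoms-reduct⊆ X (F ∧n G) =
  [ ∈-++⁺ˡ ∘ atoms-reduct⊆ X F , ∈-++⁺ʳ _ ∘ atoms-reduct⊆ X G ] ∘ ∈-++⁻ _
atoms-reduct⊆ X (F ∨n G) =
  [ ∈-++⁺ˡ ∘ atoms-reduct⊆ X F , ∈-++⁺ʳ _ ∘ atoms-reduct⊆ X G ] ∘ ∈-++⁻ _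
atoms-reduct⊆ X (¬n F) with sat X (reductN X F)
... | true  = λ ()
... | false = λ ()

reduct-equivalent : ∀ {Δ X} F → (∀ {y} → y ∈ atoms (toF F) → Settles Δ X (atom y)) →
                    Δ ⊢ toB (reductN X F) ←f toF F × Δ ⊢ toF F ←f toB (reductN X F)
reduct-equivalent (atom a) s = →I hyp₀ , →I hyp₀
reduct-equivalent ⊥n       s = →I hyp₀ , →I hyp₀
reduct-equivalent ⊤n       s = →I hyp₀ , →I hyp₀
reduct-equivalent (F ∧n G) s =
  let F→ , F← = reduct-equivalent F (s ∘ ∈-++⁺ˡ)
      G→ , G← = reduct-equivalent G (s ∘ ∈-++⁺ʳ _)
  in ∧-mono F→ G→ , ∧-mono F← G←
reduct-equivalent (F ∨n G) s =
  let F→ , F← = reduct-equivalent F (s ∘ ∈-++⁺ˡ)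
      G→ , G← = reduct-equivalent G (s ∘ ∈-++⁺ʳ _)
  in ∨-mono F→ G→ , ∨-mono F← G←
reduct-equivalent {X = X} (¬n F) s
  with sat X (reductN X F) | ⟦toF⟧⇔sat-reduct X F | settles (toF F) s
... | true  | _  | inj₁ (_ , ¬¬F) = ¬¬F , →I (⊥E hyp₀)
... | false | _  | inj₂ (_ , ¬F)  = →I ⊤-intro , →I (weaken₁ ¬F)
... | true  | F⇔ | inj₂ (f✗ , _)  = ⊥-elim (f✗ (from F⇔ refl))
... | false | F⇔ | inj₁ (f , _)   = contradiction (to F⇔ f) λ ()

Model⇔⟦clauses⟧ : ∀ {X P} → Model X P ⇔ (∀ {c} → c ∈ P → ⟦ clauseF c ⟧ X)
Model⇔⟦clauses⟧ {X} = mk⇔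
  (λ model {c} c∈P → from (⟦toF⟧⇔evalN X _) ∘ model {c} c∈P ∘ to (⟦toF⟧⇔evalN X _))
  (λ holds {c} c∈P → to (⟦toF⟧⇔evalN X _) ∘ holds {c} c∈P ∘ from (⟦toF⟧⇔evalN X _))

model⇒closed-reduct : ∀ {X P} → Model X P → Closed X (reduct X P)
model⇒closed-reduct {X} model c∈ with ∈-reduct⁻ c∈
... | (H ⇐ B) , c∈P , refl =
  λ b → trans (sat-reduct X H) (model c∈P (trans (sym (sat-reduct X B)) b))

-- The theory P ∪ ¬M̄

OccursN⇔∈atoms : ∀ {a} F → OccursN a F ⇔ a ∈ atoms (toF F)
OccursN⇔∈atoms (atom b) = mk⇔ (λ { here → here refl }) (λ { (here refl) → here })
OccursN⇔∈atoms ⊥n       = mk⇔ (λ ()) (λ ())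
OccursN⇔∈atoms ⊤n       = mk⇔ (λ ()) (λ ())
OccursN⇔∈atoms (F ∧n G) with OccursN⇔∈atoms F | OccursN⇔∈atoms G
... | F⇔ | G⇔ = mk⇔ (λ { (∧l o) → ∈-++⁺ˡ (to F⇔ o) ; (∧r o) → ∈-++⁺ʳ _ (to G⇔ o) })
                    ([ ∧l ∘ from F⇔ , ∧r ∘ from G⇔ ] ∘ ∈-++⁻ _)
OccursN⇔∈atoms (F ∨n G) with OccursN⇔∈atoms F | OccursN⇔∈atoms G
... | F⇔ | G⇔ = mk⇔ (λ { (∨l o) → ∈-++⁺ˡ (to F⇔ o) ; (∨r o) → ∈-++⁺ʳ _ (to G⇔ o) })
                    ([ ∨l ∘ from F⇔ , ∨r ∘ from G⇔ ] ∘ ∈-++⁻ _)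
OccursN⇔∈atoms (¬n F) with OccursN⇔∈atoms F
... | F⇔ = mk⇔ (λ { (¬o o) → to F⇔ o }) (¬o ∘ from F⇔)

σ : Program → List Atom
σ = concatMap (atoms ∘ clauseF)

∈σ⇔∈-σ : ∀ {a P} → a ∈σ P ⇔ a ∈ σ P
∈σ⇔∈-σ = mk⇔ (∈-concatMap⁺ (atoms ∘ clauseF) ∘ Any.map (to (OccursC⇔ _)))
              (Any.map (from (OccursC⇔ _)) ∘ ∈-concatMap⁻ (atoms ∘ clauseF))
  where
  OccursC⇔ : ∀ {a} c → OccursC a c ⇔ a ∈ atoms (clauseF c)
  OccursC⇔ (H ⇐ B) = mk⇔ [ ∈-++⁺ˡ ∘ to (OccursN⇔∈atoms H) , ∈-++⁺ʳ _ ∘ to (OccursN⇔∈atoms B) ]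
                          (Sum.map (from (OccursN⇔∈atoms H)) (from (OccursN⇔∈atoms B)) ∘ ∈-++⁻ _)

module _ (P : Program) (M : AtomSet) where

  Γ : List Formula
  Γ = map clauseF P ++ map (λ y → ¬f atom y) (filter (λ y → M y ≟ false) (σ P))

  clause∈Γ : ∀ {c} → c ∈ P → clauseF c ∈ Γ
  clause∈Γ c∈P = ∈-++⁺ˡ (∈-map⁺ clauseF c∈P)

  ¬atom∈Γ : ∀ {y} → y ∈ σ P → M y ≡ false → ¬f atom y ∈ Γ
  ¬atom∈Γ y∈σ My = ∈-++⁺ʳ _ (∈-map⁺ (λ y → ¬f atom y) (∈-filter⁺ _ y∈σ My))

  clause-atom∈σ : ∀ {c y} → c ∈ P → y ∈ atoms (clauseF c) → y ∈ σ P
  clause-atom∈σ c∈P y∈c = ∈-concatMap⁺ (atoms ∘ clauseF) (lose c∈P y∈c)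

  PNegComp⇒∈Γ : ∀ {G} → PNegComp P M G → G ∈ Γ
  PNegComp⇒∈Γ (prog c∈P)   = clause∈Γ c∈P
  PNegComp⇒∈Γ (neg a∈σ Ma) = ¬atom∈Γ (to ∈σ⇔∈-σ a∈σ) Ma

  ∈Γ⇒PNegComp : ∀ {G} → G ∈ Γ → PNegComp P M G
  ∈Γ⇒PNegComp G∈Γ with ∈-++⁻ (map clauseF P) G∈Γ
  ... | inj₁ G∈P with ∈-map⁻ clauseF G∈P
  ...   | c , c∈P , refl = prog c∈P
  ∈Γ⇒PNegComp G∈Γ | inj₂ G∈¬ with ∈-map⁻ (λ y → ¬f atom y) G∈¬
  ...   | y , y∈ , refl = let y∈σ , My = ∈-filter⁻ _ y∈ in neg (from ∈σ⇔∈-σ y∈σ) My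

  Γ-holds : ∀ {Y} → Model Y P → Y ⊆ₛ M → All (λ G → ⟦ G ⟧ Y) Γ
  Γ-holds {Y} model Y⊆M = All.tabulate (holds ∘ ∈Γ⇒PNegComp)
    where
    holds : ∀ {G} → PNegComp P M G → ⟦ G ⟧ Y
    holds (prog c∈P)     = to Model⇔⟦clauses⟧ model c∈P
    holds (neg {a} _ Ma) = (λ ()) ∘ trans (sym Ma) ∘ Y⊆M a

  Γ-holdsₕₜ : ∀ {Y} → Model M P → Closed Y (reduct M P) → Y ⊆ₛ M → All (λ G → ⟦ G ⟧ₕₜ Y M) Γ
  Γ-holdsₕₜ {Y} model closed Y⊆M = All.tabulate (holds ∘ ∈Γ⇒PNegComp)
    where
    holds : ∀ {G} → PNegComp P M G → ⟦ G ⟧ₕₜ Y M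
    holds (prog {H ⇐ B} c∈P) =
      from (⟦toF⟧ₕₜ⇔sat-reduct Y⊆M H) ∘ closed (∈-reduct⁺ c∈P) ∘ to (⟦toF⟧ₕₜ⇔sat-reduct Y⊆M B) ,
      to Model⇔⟦clauses⟧ model c∈P
    holds (neg {a} _ Ma) = (λ ()) ∘ trans (sym Ma) ∘ Y⊆M a , (λ ()) ∘ trans (sym Ma)

  settles-σ : (∀ {x} → x ∈ₛ M → Γ ⊢ ¬f ¬f atom x) → ∀ {y} → y ∈ σ P → Settles Γ M (atom y)
  settles-σ ⊢¬¬M {y} y∈σ with M y in My
  ... | true  = inj₁ (refl , ⊢¬¬M My)
  ... | false = inj₂ ((λ ()) , hyp (¬atom∈Γ y∈σ My))

  settled⇒model : (∀ {y} → y ∈ σ P → Settles Γ M (atom y)) → ¬ (Γ ⊢ ⊥f) → Model M P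
  settled⇒model settled consistent = from Model⇔⟦clauses⟧ λ {c} c∈P →
    [ proj₁ , (λ (_ , ⊢¬c) → ⊥-elim (consistent (→E ⊢¬c (hyp (clause∈Γ c∈P))))) ]
      (settles (clauseF c) (settled ∘ clause-atom∈σ c∈P))

  ⊢ₛ⇒minimal-model : Γ ⊢ₛ M → ∀ Y → Model Y P → Y ⊆ₛ M → M ⊆ₛ Y
  ⊢ₛ⇒minimal-model ⊢M Y model Y⊆M a a∈M = ⟦⟧-sound Y (⊢M a∈M) (Γ-holds model Y⊆M)

  ⊢ₛ⇒minimal-closed : Γ ⊢ₛ M → Model M P → ∀ Y → Closed Y (reduct M P) → Y ⊆ₛ M → M ⊆ₛ Y
  ⊢ₛ⇒minimal-closed ⊢M model Y closed Y⊆M a a∈M =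
    ⟦⟧ₕₜ-sound Y⊆M (⊢M a∈M) (Γ-holdsₕₜ model closed Y⊆M)

  model⇒consistent : Model M P → ¬ (Γ ⊢ ⊥f)
  model⇒consistent model d = ⟦⟧-sound M d (Γ-holds model (λ _ → id))

  -- Γ forces N to omit the atoms of σ P outside M, so N and N ∩ M agree on σ P.
  Γ-model-∩ : ∀ N → All (λ G → ⟦ G ⟧ N) Γ → Model (N ∩ M) P
  Γ-model-∩ N holds = from Model⇔⟦clauses⟧ λ {c} c∈P →
    ⟦⟧-cong (clauseF c) (agree ∘ clause-atom∈σ c∈P) (All.lookup holds (clause∈Γ c∈P))
    where
    agree : ∀ {y} → y ∈ σ P → N y ≡ (N ∩ M) y
    agree {y} y∈σ with M y in My
    ... | true  = sym (∧-identityʳ (N y))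
    ... | false = trans (¬-not (All.lookup holds (¬atom∈Γ y∈σ My))) (sym (∧-zeroʳ (N y)))

  -- A classical model N of Γ, ¬x would make N ∩ M a model of P below M omitting x.
  minimal-model⇒⊢¬¬ : (∀ Y → Model Y P → Y ⊆ₛ M → M ⊆ₛ Y) → ∀ {x} → x ∈ₛ M → Γ ⊢ ¬f ¬f atom x
  minimal-model⇒⊢¬¬ minimal {x} x∈M = →I (glivenko (¬f atom x ∷ Γ) λ { N (¬Nx ∷ holds) →
    ¬Nx (X∩Y⊆X {N} {M} x (minimal (N ∩ M) (Γ-model-∩ N holds) (X∩Y⊆Y {N}) x x∈M)) })

  min-answer-set⇒⊢ₛ : MinAnswerSet M P → Γ ⊢ₛ M
  min-answer-set⇒⊢ₛ ((_ , minimalₐ) , (_ , minimalₘ)) = minimal-closed⇒⊢ₛ minimalₐ ⊢clause ⊢¬head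
    where
    settled : ∀ {y} → y ∈ σ P → Settles Γ M (atom y)
    settled = settles-σ (minimal-model⇒⊢¬¬ minimalₘ)

    ⊢clause : ∀ {H B} → H ⇐b B ∈ reduct M P → Γ ⊢ toB H ←f toB B
    ⊢clause c∈ with ∈-reduct⁻ c∈
    ... | (H ⇐ B) , c∈P , refl =
      let H→ , _ = reduct-equivalent H (settled ∘ clause-atom∈σ c∈P ∘ ∈-++⁺ˡ)
          _ , B← = reduct-equivalent B (settled ∘ clause-atom∈σ c∈P ∘ ∈-++⁺ʳ _)
      in ←-trans H→ (←-trans (hyp (clause∈Γ c∈P)) B←)

    ⊢¬head : ∀ {H B y} → H ⇐b B ∈ reduct M P → y ∈ atoms (toB H) → M y ≡ false → Γ ⊢ ¬f atom y
    ⊢¬head c∈ y∈H My with ∈-reduct⁻ c∈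
    ... | (H ⇐ B) , c∈P , refl =
      hyp (¬atom∈Γ (clause-atom∈σ c∈P (∈-++⁺ˡ (atoms-reduct⊆ M H y∈H))) My)

theorem5p2 : (P : Program) (M : AtomSet) →
    MinAnswerSet M P ⇔ (PNegComp P M ⊢cI M)
theorem5p2 P M = mk⇔ forward backward
  where
  ⊢I⇒⊢Γ : ∀ {F} → PNegComp P M ⊢I F → Γ P M ⊢ F
  ⊢I⇒⊢Γ = ⊢I⇒⊢ (PNegComp⇒∈Γ P M)

  ⊢Γ⇒⊢I : ∀ {F} → Γ P M ⊢ F → PNegComp P M ⊢I F
  ⊢Γ⇒⊢I = ⊢⇒⊢I (All.tabulate (∈Γ⇒PNegComp P M))

  forward : MinAnswerSet M P → PNegComp P M ⊢cI M
  forward min@(_ , model , _) =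
    model⇒consistent P M model ∘ ⊢I⇒⊢Γ , λ _ a∈M → ⊢Γ⇒⊢I (min-answer-set⇒⊢ₛ P M min a∈M)

  backward : PNegComp P M ⊢cI M → MinAnswerSet M P
  backward (consistent , ⊢I-M) =
    (model⇒closed-reduct model , ⊢ₛ⇒minimal-closed P M ⊢M model) , model , ⊢ₛ⇒minimal-model P M ⊢M
    where
    ⊢M : Γ P M ⊢ₛ M
    ⊢M a∈M = ⊢I⇒⊢Γ (⊢I-M _ a∈M)

    model : Model M P
    model = settled⇒model P M (settles-σ P M (¬¬-intro ∘ ⊢M)) (consistent ∘ ⊢Γ⇒⊢I)
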